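{- Let $n\ge1$ and $X\subseteq [n-1]$. For $i=0,1,\ldots,n$ define \[f_X(i)= \#\{j \in X: j < i\}+\begin{cases} n-i &\text{if } i \not\in X, \\ 0 &\text{if } i \in X.\end{cases}\] Then $f_X$ is a permutation of $\{0,1,\dots,n\}$. -}

module Defs where

open import Data.Nat using (ℕ; suc; _+_; _∸_; _<_)
open import Data.Fin using (Fin; toℕ)
open import Data.Fin.Subset using (Subset; _∈_; _∉_)
open import Data.Fin.Subset.Properties using (_∈?_)
open import Data.List using (List; length; filter)
open import Data.List using () renaming (allFin to allFinL)
open import Data.Fin.Properties using (_<?_)
open import Data.Product using (_×_)
open import Relation.Nullary using (yes; no)

-- The points 0,1,…,n are represented by Fin (suc n).
-- A subset X ⊆ [n-1] = {1,…,n-1} is a subset of Fin (suc n) avoiding 0 and n.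
IsSubsetOfBracket : (n : ℕ) → Subset (suc n) → Set
IsSubsetOfBracket n X = (∀ (j : Fin (suc n)) → j ∈ X → (0 < toℕ j) × (toℕ j < n))

countBelow : {n : ℕ} → Subset (suc n) → Fin (suc n) → ℕ
countBelow {n} X i = length (filter (λ j → j ∈? X) (filter (λ j → j <? i) (allFinL (suc n))))

fX : (n : ℕ) → Subset (suc n) → Fin (suc n) → ℕ
fX n X i with i ∈? X
... | yes _ = countBelow X i
... | no  _ = countBelow X i + (n ∸ toℕ i)

{-# OPTIONS --safe #-}
-- Let c(i) = #{j ∈ X : j < i}. It is nondecreasing, increases exactly at the steps
-- i → i+1 with i ∈ X, and increases by at most j − i from i to j. So for i < j:
-- if i ∈ X then f(i) = c(i) < c(i+1) ≤ c(j) ≤ f(j), and if i ∉ X then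
-- f(j) ≤ c(j) + (n − j) ≤ c(i) + (n − i − 1) < f(i). Hence f_X is an injective
-- self-map of {0,…,n}, and therefore a permutation.
module Submission where

open import Defs
open import Data.Bool using (true; false)
open import Data.Empty using (⊥-elim)
open import Data.Fin as Fin using (Fin; toℕ; fromℕ<; punchOut)
open import Data.Fin.Permutation using (Permutation′; _⟨$⟩ʳ_; permutation)
open import Data.Fin.Properties as Finₚ
  using (toℕ-fromℕ<; toℕ≤pred[n]; injective⇒≤; punchOut-injective; any?)
open import Data.Fin.Subset using (Subset; _∈_; _∉_)
open import Data.Fin.Subset.Properties using (_∈?_)
open import Data.List using (List; []; _∷_; length; filter; map; tabulate)
open import Data.List using () renaming (allFin to allFinL)
open import Data.List.Properties using (length-map; map-tabulate; filter-none)
open import Data.List.Relation.Unary.All.Properties using (tabulate⁺)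
open import Data.Nat using (ℕ; zero; suc; _+_; _∸_; _≤_; _<_; _≤?_; z≤n; s≤s)
open import Data.Nat.Properties
  using (m+[n∸m]≡n; 1+n≰n; m≤n⇒m≤1+n; m≤m+n; n<1+n; ≤-reflexive; ≤-trans; +-assoc;
         +-monoˡ-≤; +-monoʳ-<; ∸-monoʳ-<; <⇒≢; module ≤-Reasoning)
open import Data.Product using (Σ; ∃; _,_; proj₁; proj₂)
open import Data.Vec using (here; there)
  renaming ([] to []ᵥ; _∷_ to _∷ᵥ_)
open import Function using (_∘_; case_of_)
open import Function.Definitions using (Injective)
open import Relation.Binary.Definitions using (tri<; tri≈; tri>)
open import Relation.Binary.PropositionalEquality
open import Relation.Nullary using (yes; no; does; contradiction)
open import Relation.Unary using (Decidable)

[n∸m]+[o∸n]≡o∸m : ∀ {m n o} → m ≤ n → n ≤ o → (n ∸ m) + (o ∸ n) ≡ o ∸ m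
[n∸m]+[o∸n]≡o∸m z≤n       n≤o       = m+[n∸m]≡n n≤o
[n∸m]+[o∸n]≡o∸m (s≤s m≤n) (s≤s n≤o) = [n∸m]+[o∸n]≡o∸m m≤n n≤o

filter-map : ∀ {A B : Set} {P : A → Set} {Q : B → Set} (P? : Decidable P) (Q? : Decidable Q)
             (f : A → B) → (∀ x → does (Q? (f x)) ≡ does (P? x)) →
             ∀ xs → filter Q? (map f xs) ≡ map f (filter P? xs)
filter-map P? Q? f agree []       = refl
filter-map P? Q? f agree (x ∷ xs) rewrite agree x with does (P? x)
... | true  = cong (f x ∷_) (filter-map P? Q? f agree xs)
... | false = filter-map P? Q? f agree xs

injective⇒preimage : ∀ {k} (f : Fin k → Fin k) → Injective _≡_ _≡_ f → ∀ y → ∃ λ x → f x ≡ y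
injective⇒preimage {suc k} f f-inj y with any? (λ x → f x Finₚ.≟ y)
... | yes found = found
... | no  ¬hit  = contradiction (injective⇒≤ squeeze-inj) 1+n≰n
  where
  y≢f : ∀ x → y ≢ f x
  y≢f x y≡fx = ¬hit (x , sym y≡fx)
  squeeze : Fin (suc k) → Fin k
  squeeze x = punchOut (y≢f x)
  squeeze-inj : Injective _≡_ _≡_ squeeze
  squeeze-inj {x} {x′} = f-inj ∘ punchOut-injective (y≢f x) (y≢f x′)

injective⇒permutation : ∀ {k} (f : Fin k → Fin k) → Injective _≡_ _≡_ f →
                        Σ (Permutation′ k) (λ π → ∀ i → π ⟨$⟩ʳ i ≡ f i)
injective⇒permutation {k} f f-inj = permutation f f⁻¹ f∘f⁻¹ f⁻¹∘f , λ _ → refl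
  where
  f⁻¹ : Fin k → Fin k
  f⁻¹ y = proj₁ (injective⇒preimage f f-inj y)
  f∘f⁻¹ : ∀ y → f (f⁻¹ y) ≡ y
  f∘f⁻¹ y = proj₂ (injective⇒preimage f f-inj y)
  f⁻¹∘f : ∀ x → f⁻¹ (f x) ≡ x
  f⁻¹∘f x = f-inj (f∘f⁻¹ (f x))

count< : ∀ {k} → Subset k → ℕ → ℕ
count< []ᵥ           m       = 0
count< (b ∷ᵥ X)      zero    = 0
count< (true ∷ᵥ X)   (suc m) = suc (count< X m)
count< (false ∷ᵥ X)  (suc m) = count< X m

count<-zero : ∀ {k} (X : Subset k) → count< X 0 ≡ 0
count<-zero []ᵥ      = refl
count<-zero (_ ∷ᵥ _) = refl

count<-≤ : ∀ {k} (X : Subset k) m → count< X m ≤ m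
count<-≤ []ᵥ          m       = z≤n
count<-≤ (b ∷ᵥ X)     zero    = z≤n
count<-≤ (true ∷ᵥ X)  (suc m) = s≤s (count<-≤ X m)
count<-≤ (false ∷ᵥ X) (suc m) = m≤n⇒m≤1+n (count<-≤ X m)

count<-mono-≤ : ∀ {k} (X : Subset k) {m m′} → m ≤ m′ → count< X m ≤ count< X m′
count<-mono-≤ []ᵥ          _         = z≤n
count<-mono-≤ (b ∷ᵥ X)     z≤n       = z≤n
count<-mono-≤ (true ∷ᵥ X)  (s≤s m≤m′) = s≤s (count<-mono-≤ X m≤m′)
count<-mono-≤ (false ∷ᵥ X) (s≤s m≤m′) = count<-mono-≤ X m≤m′

count<-+-≤ : ∀ {k} (X : Subset k) m d → count< X (m + d) ≤ count< X m + d
count<-+-≤ []ᵥ          m       d = z≤n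
count<-+-≤ (b ∷ᵥ X)     zero    d = count<-≤ (b ∷ᵥ X) d
count<-+-≤ (true ∷ᵥ X)  (suc m) d = s≤s (count<-+-≤ X m d)
count<-+-≤ (false ∷ᵥ X) (suc m) d = count<-+-≤ X m d

count<-∸-≤ : ∀ {k} (X : Subset k) {m m′} → m ≤ m′ → count< X m′ ≤ count< X m + (m′ ∸ m)
count<-∸-≤ X {m} {m′} m≤m′ =
  subst (λ t → count< X t ≤ count< X m + (m′ ∸ m)) (m+[n∸m]≡n m≤m′) (count<-+-≤ X m (m′ ∸ m))

count<-suc-∈ : ∀ {k} (X : Subset k) {i} → i ∈ X → count< X (suc (toℕ i)) ≡ suc (count< X (toℕ i))
count<-suc-∈ (true ∷ᵥ X)  {Fin.zero}  here      = cong suc (count<-zero X)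
count<-suc-∈ (true ∷ᵥ X)  {Fin.suc i} (there p) = cong suc (count<-suc-∈ X p)
count<-suc-∈ (false ∷ᵥ X) {Fin.suc i} (there p) = count<-suc-∈ X p

count<-suc-∉ : ∀ {k} (X : Subset k) {i} → i ∉ X → count< X (suc (toℕ i)) ≡ count< X (toℕ i)
count<-suc-∉ (true ∷ᵥ X)  {Fin.zero}  i∉X = ⊥-elim (i∉X here)
count<-suc-∉ (false ∷ᵥ X) {Fin.zero}  i∉X = count<-zero X
count<-suc-∉ (true ∷ᵥ X)  {Fin.suc i} i∉X = cong suc (count<-suc-∉ X (i∉X ∘ there))
count<-suc-∉ (false ∷ᵥ X) {Fin.suc i} i∉X = count<-suc-∉ X (i∉X ∘ there)

below? : ∀ {k} m → Decidable (λ (j : Fin k) → suc (toℕ j) ≤ m)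
below? m j = suc (toℕ j) ≤? m

length-filter-∈-below : ∀ {k} (X : Subset k) m →
  length (filter (_∈? X) (filter (below? m) (allFinL k))) ≡ count< X m
length-filter-∈-below []ᵥ m = refl
length-filter-∈-below {suc k} (b ∷ᵥ X) zero =
  cong (length ∘ filter (_∈? (b ∷ᵥ X))) (filter-none (below? 0) (tabulate⁺ {f = Fin.suc} λ _ ()))
length-filter-∈-below {suc k} (b ∷ᵥ X) (suc m) = begin
  length (filter (_∈? (b ∷ᵥ X)) (Fin.zero ∷ filter (below? (suc m)) (tabulate Fin.suc)))
    ≡⟨ cong (λ L → length (filter (_∈? (b ∷ᵥ X)) (Fin.zero ∷ filter (below? (suc m)) L)))
            (sym (map-tabulate (λ j → j) Fin.suc)) ⟩
  length (filter (_∈? (b ∷ᵥ X)) (Fin.zero ∷ filter (below? (suc m)) (map Fin.suc (allFinL k))))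
    ≡⟨ cong (λ L → length (filter (_∈? (b ∷ᵥ X)) (Fin.zero ∷ L)))
            (filter-map (below? m) (below? (suc m)) Fin.suc (λ _ → refl) (allFinL k)) ⟩
  length (filter (_∈? (b ∷ᵥ X)) (Fin.zero ∷ map Fin.suc F))
    ≡⟨ head-and-tail b ⟩
  count< (b ∷ᵥ X) (suc m) ∎
  where
  open ≡-Reasoning
  F : List (Fin k)
  F = filter (below? m) (allFinL k)
  tail : ∀ b → length (filter (_∈? (b ∷ᵥ X)) (map Fin.suc F)) ≡ count< X m
  tail b = begin
    length (filter (_∈? (b ∷ᵥ X)) (map Fin.suc F))
      ≡⟨ cong length (filter-map (_∈? X) (_∈? (b ∷ᵥ X)) Fin.suc (λ _ → refl) F) ⟩
    length (map Fin.suc (filter (_∈? X) F))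
      ≡⟨ length-map Fin.suc (filter (_∈? X) F) ⟩
    length (filter (_∈? X) F)
      ≡⟨ length-filter-∈-below X m ⟩
    count< X m ∎
  head-and-tail : ∀ b → length (filter (_∈? (b ∷ᵥ X)) (Fin.zero ∷ map Fin.suc F)) ≡ count< (b ∷ᵥ X) (suc m)
  head-and-tail true  = cong suc (tail true)
  head-and-tail false = tail false

countBelow≡count< : ∀ {n} (X : Subset (suc n)) i → countBelow X i ≡ count< X (toℕ i)
countBelow≡count< X i = length-filter-∈-below X (toℕ i)

module _ (n : ℕ) (X : Subset (suc n)) where

  private
    c : Fin (suc n) → ℕ
    c i = count< X (toℕ i)

  fX-∈ : ∀ {i} → i ∈ X → fX n X i ≡ c i
  fX-∈ {i} i∈X with i ∈? X
  ... | yes _    = countBelow≡count< X i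
  ... | no i∉X  = contradiction i∈X i∉X

  fX-∉ : ∀ {i} → i ∉ X → fX n X i ≡ c i + (n ∸ toℕ i)
  fX-∉ {i} i∉X with i ∈? X
  ... | yes i∈X = contradiction i∈X i∉X
  ... | no _    = cong (_+ (n ∸ toℕ i)) (countBelow≡count< X i)

  c≤fX : ∀ i → c i ≤ fX n X i
  c≤fX i = case i ∈? X of λ where
    (yes i∈X) → ≤-reflexive (sym (fX-∈ i∈X))
    (no i∉X)  → ≤-trans (m≤m+n (c i) (n ∸ toℕ i)) (≤-reflexive (sym (fX-∉ i∉X)))

  fX≤c+[n∸i] : ∀ i → fX n X i ≤ c i + (n ∸ toℕ i)
  fX≤c+[n∸i] i = case i ∈? X of λ where
    (yes i∈X) → ≤-trans (≤-reflexive (fX-∈ i∈X)) (m≤m+n (c i) (n ∸ toℕ i))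
    (no i∉X)  → ≤-reflexive (fX-∉ i∉X)

  fX<1+n : ∀ i → fX n X i < suc n
  fX<1+n i = s≤s (begin
    fX n X i              ≤⟨ fX≤c+[n∸i] i ⟩
    c i + (n ∸ toℕ i)     ≤⟨ +-monoˡ-≤ (n ∸ toℕ i) (count<-≤ X (toℕ i)) ⟩
    toℕ i + (n ∸ toℕ i)   ≡⟨ m+[n∸m]≡n (toℕ≤pred[n] i) ⟩
    n                     ∎)
    where open ≤-Reasoning

  ∈⇒fX-< : ∀ {i j} → toℕ i < toℕ j → i ∈ X → fX n X i < fX n X j
  ∈⇒fX-< {i} {j} i<j i∈X = begin-strict
    fX n X i                  ≡⟨ fX-∈ i∈X ⟩
    c i                       <⟨ n<1+n (c i) ⟩
    suc (c i)                 ≡⟨ count<-suc-∈ X i∈X ⟨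
    count< X (suc (toℕ i))    ≤⟨ count<-mono-≤ X i<j ⟩
    c j                       ≤⟨ c≤fX j ⟩
    fX n X j                  ∎
    where open ≤-Reasoning

  ∉⇒fX-> : ∀ {i j} → toℕ i < toℕ j → i ∉ X → fX n X j < fX n X i
  ∉⇒fX-> {i} {j} i<j i∉X = begin-strict
    fX n X j                                            ≤⟨ fX≤c+[n∸i] j ⟩
    c j + (n ∸ toℕ j)                                   ≤⟨ +-monoˡ-≤ (n ∸ toℕ j) (count<-∸-≤ X i<j) ⟩
    count< X (suc (toℕ i)) + (toℕ j ∸ suc (toℕ i)) + (n ∸ toℕ j)
      ≡⟨ cong (λ t → t + (toℕ j ∸ suc (toℕ i)) + (n ∸ toℕ j)) (count<-suc-∉ X i∉X) ⟩
    c i + (toℕ j ∸ suc (toℕ i)) + (n ∸ toℕ j)           ≡⟨ +-assoc (c i) _ _ ⟩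
    c i + ((toℕ j ∸ suc (toℕ i)) + (n ∸ toℕ j))         ≡⟨ cong (c i +_) ([n∸m]+[o∸n]≡o∸m i<j (toℕ≤pred[n] j)) ⟩
    c i + (n ∸ suc (toℕ i))                             <⟨ +-monoʳ-< (c i) (∸-monoʳ-< (n<1+n (toℕ i)) i<n) ⟩
    c i + (n ∸ toℕ i)                                   ≡⟨ fX-∉ i∉X ⟨
    fX n X i                                            ∎
    where
    open ≤-Reasoning
    i<n : suc (toℕ i) ≤ n
    i<n = ≤-trans i<j (toℕ≤pred[n] j)

  <⇒fX-≢ : ∀ {i j} → toℕ i < toℕ j → fX n X i ≢ fX n X j
  <⇒fX-≢ {i} i<j = case i ∈? X of λ where
    (yes i∈X) → <⇒≢ (∈⇒fX-< i<j i∈X)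
    (no i∉X)  → ≢-sym (<⇒≢ (∉⇒fX-> i<j i∉X))

  fX-injective : Injective _≡_ _≡_ (fX n X)
  fX-injective {i} {j} fXi≡fXj with Finₚ.<-cmp i j
  ... | tri< i<j _ _ = contradiction fXi≡fXj (<⇒fX-≢ i<j)
  ... | tri≈ _ i≡j _ = i≡j
  ... | tri> _ _ j<i = contradiction (sym fXi≡fXj) (<⇒fX-≢ j<i)

  fXᶠ : Fin (suc n) → Fin (suc n)
  fXᶠ i = fromℕ< (fX<1+n i)

  toℕ-fXᶠ : ∀ i → toℕ (fXᶠ i) ≡ fX n X i
  toℕ-fXᶠ i = toℕ-fromℕ< (fX<1+n i)

  fXᶠ-injective : Injective _≡_ _≡_ fXᶠ
  fXᶠ-injective {i} {j} fᵢ≡fⱼ = fX-injective (begin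
    fX n X i      ≡⟨ toℕ-fXᶠ i ⟨
    toℕ (fXᶠ i)   ≡⟨ cong toℕ fᵢ≡fⱼ ⟩
    toℕ (fXᶠ j)   ≡⟨ toℕ-fXᶠ j ⟩
    fX n X j      ∎)
    where open ≡-Reasoning

lemma2p7 : (n : ℕ) → 1 ≤ n → (X : Subset (suc n)) → IsSubsetOfBracket n X →
    Σ (Permutation′ (suc n)) (λ π → ∀ (i : Fin (suc n)) → toℕ (π ⟨$⟩ʳ i) ≡ fX n X i)
lemma2p7 n _ X _ =
  let π , π≡fXᶠ = injective⇒permutation (fXᶠ n X) (fXᶠ-injective n X)
  in  π , λ i → trans (cong toℕ (π≡fXᶠ i)) (toℕ-fXᶠ n X i)
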